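{- Let $k\geq 4$ and $n>k$ be integers, and let $G$ be a $2$-connected graph on $n$ vertices with chromatic number $\chi(G)=k$. Suppose $G$ contains a subgraph $H$ obtained as follows: start with a $k$-clique $K_k$; attach a path $Q_1$ whose endpoints are distinct vertices $u,v$ of $K_k$ and whose internal vertices are new (not in $K_k$); then attach a path $Q_2$ whose one endpoint is an internal vertex of $Q_1$, whose other endpoint lies in $V(K_k)\setminus\{u,v\}$, and whose internal vertices are new (not in $K_k\cup Q_1$). Assume $|V(Q_1)|\geq 3$ and $|V(Q_2)|\geq 3$. Then for every integer $x\geq k$, $$P(G,x)< (x-1)_{k-1}\big((x-1)^{n-k+1}+(-1)^{n-k}\big).$$
   Context: All graphs are finite and simple. $P(G,x)$ denotes the chromatic polynomial of $G$, i.e., for a positive integer $x$ the number of proper colorings $c:V(G)\to\{1,\dots,x\}$. $(x)_m=x(x-1)\cdots(x-m+1)$ denotes the falling factorial. $|V(Q)|$ is the number of vertices of the path $Q$, including its endpoints. -}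

module Defs where

open import Data.Nat using (ℕ; zero; suc; _+_; _*_; _∸_; _≤_; _<_)
open import Data.Fin using (Fin; zero; suc)
open import Data.Fin.Properties using (all?)
open import Data.Bool using (Bool; true; false)
open import Data.List using (List; []; _∷_; _++_; [_]; length; map; concatMap; allFin; filter)
open import Data.List.Relation.Unary.Linked using (Linked)
open import Data.List.Relation.Unary.Unique.Propositional using (Unique)
open import Data.List.Membership.Propositional using (_∈_; _∉_)
open import Data.Product using (Σ; _×_; _,_; ∃)
open import Data.Empty using (⊥)
open import Relation.Nullary using (¬_; Dec)
open import Relation.Nullary.Decidable using (_→-dec_; ¬?)
open import Relation.Binary.PropositionalEquality using (_≡_; _≢_)
open import Data.Bool.Properties using () renaming (_≟_ to _≟ᵇ_)
import Data.Fin.Properties as FinP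

record Graph (n : ℕ) : Set where
  field
    adj   : Fin n → Fin n → Bool
    sym   : ∀ u v → adj u v ≡ adj v u
    irrfl : ∀ v → adj v v ≡ false

open Graph public

Adj : ∀ {n} → Graph n → Fin n → Fin n → Set
Adj G u v = adj G u v ≡ true

Proper : ∀ {n x} → Graph n → (Fin n → Fin x) → Set
Proper G c = ∀ u v → Adj G u v → c u ≢ c v

proper? : ∀ {n x} (G : Graph n) (c : Fin n → Fin x) → Dec (Proper G c)
proper? G c = all? λ u → all? λ v →
  (adj G u v ≟ᵇ true) →-dec ¬? (c u FinP.≟ c v)

consF : ∀ {n x} → Fin x → (Fin n → Fin x) → Fin (suc n) → Fin x
consF a f zero    = a
consF a f (suc i) = f i

allMaps : (n x : ℕ) → List (Fin n → Fin x)
allMaps zero    x = (λ ()) ∷ []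
allMaps (suc n) x = concatMap (λ a → map (consF a) (allMaps n x)) (allFin x)

chromPoly : ∀ {n} → Graph n → ℕ → ℕ
chromPoly {n} G x = length (filter (proper? G) (allMaps n x))

ChromaticNumber : ∀ {n} → Graph n → ℕ → Set
ChromaticNumber {n} G k =
  (Σ (Fin n → Fin k) (Proper G)) × ¬ (Σ (Fin n → Fin (k ∸ 1)) (Proper G))

-- Reach G X u v : there is a walk from u to v in G - X
data Reach {n} (G : Graph n) (X : Fin n → Set) : Fin n → Fin n → Set where
  here : ∀ {u} → ¬ X u → Reach G X u u
  step : ∀ {u v w} → ¬ X u → Adj G u v → Reach G X v w → Reach G X u w

ConnectedMinus : ∀ {n} → Graph n → (Fin n → Set) → Set
ConnectedMinus {n} G X = ∀ u v → ¬ X u → ¬ X v → Reach G X u v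

-- 2-connected: more than 2 vertices and G - X connected for every |X| < 2
TwoConnected : ∀ {n} → Graph n → Set
TwoConnected {n} G =
  3 ≤ n × ConnectedMinus G (λ _ → ⊥) × (∀ w → ConnectedMinus G (λ v → v ≡ w))

IsPath : ∀ {n} → Graph n → List (Fin n) → Set
IsPath G p = Unique p × Linked (Adj G) p

-- The subgraph H of the statement:
--  * a k-clique K given by an injective f : Fin k → Fin n,
--  * Q1 = f a , I1 , f b   (a ≢ b, internal vertices I1 new, |V(Q1)| ≥ 3),
--  * Q2 = w , I2 , f c     (w an internal vertex of Q1, c ∉ {a,b},
--                           internal vertices I2 not in K ∪ Q1, |V(Q2)| ≥ 3).

NotInClique : ∀ {n k} → (Fin k → Fin n) → Fin n → Set
NotInClique f v = ∀ i → f i ≢ v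

record ThetaClique {n} (G : Graph n) (k : ℕ) : Set where
  field
    f       : Fin k → Fin n
    f-inj   : ∀ i j → f i ≡ f j → i ≡ j
    clique  : ∀ i j → i ≢ j → Adj G (f i) (f j)
    a b     : Fin k
    a≢b     : a ≢ b
    I1      : List (Fin n)
    Q1-path : IsPath G (f a ∷ I1 ++ [ f b ])
    Q1-len  : 3 ≤ length (f a ∷ I1 ++ [ f b ])
    I1-new  : ∀ v → v ∈ I1 → NotInClique f v
    w       : Fin n
    w∈I1    : w ∈ I1
    c       : Fin k
    c≢a     : c ≢ a
    c≢b     : c ≢ b
    I2      : List (Fin n)
    Q2-path : IsPath G (w ∷ I2 ++ [ f c ])
    Q2-len  : 3 ≤ length (w ∷ I2 ++ [ f c ])
    I2-new  : ∀ v → v ∈ I2 → NotInClique f v × v ∉ (f a ∷ I1 ++ [ f b ])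

fall : ℕ → ℕ → ℕ
fall x zero    = 1
fall x (suc m) = x * fall (x ∸ 1) m

-- Colour G greedily in this order: the clique K, then the "spider" formed by the vertex w where Q₂
-- leaves Q₁ together with its three paths to K, then all remaining vertices, each of which has an
-- earlier neighbour because G is connected. Bounding the colours available at each step gives
-- P(G,x) ≤ (x)_k · E · (x−1)^r, where E counts the colourings of the spider whose three feet carry
-- distinct fixed colours and r is the number of remaining vertices. Let D_ℓ count the colourings of
-- the ℓ inner vertices of a path whose ends have different fixed colours. Then E < D_p for
-- p = |spider|, and D_{ℓ+1} = (x−1)·D_ℓ − (−1)^ℓ, so E·(x−1)^r < D_m for m = n − k ≥ p + r;
-- finally (x)_k · D_m = (x−1)_{k−1} · ((x−1)^{m+1} + (−1)^m).

module Submission where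

open import Defs hiding (sym)
open import Data.Nat using (ℕ; zero; suc; _+_; _*_; _∸_; _≤_; _<_; z≤n; s≤s)
import Data.Nat as ℕ
import Data.Nat.Properties as ℕP
import Data.Integer as ℤ
open import Data.Integer using (ℤ; +_; -1ℤ; 1ℤ; _^_)
  renaming (_+_ to _+ℤ_; _*_ to _*ℤ_; _-_ to _-ℤ_; _<_ to _<ℤ_)
import Data.Integer.Properties as ℤP
open import Data.Integer.Tactic.RingSolver using (solve-∀)
open import Algebra.Properties.CommutativeSemigroup ℕP.+-commutativeSemigroup using (x∙yz≈y∙xz)
open import Algebra.Properties.CommutativeSemigroup ℕP.*-commutativeSemigroup
  using () renaming (x∙yz≈y∙xz to *-x∙yz≈y∙xz)
open import Data.Bool using (Bool; true; false; if_then_else_)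
open import Data.Bool.Properties using () renaming (_≟_ to _≟ᵇ_)
open import Data.Fin using (Fin; zero; suc)
import Data.Fin.Properties as FinP
open import Data.Maybe using (Maybe; just; nothing)
open import Data.Maybe.Properties using (just-injective)
import Data.Maybe.Properties as MaybeP
open import Data.List using (List; []; _∷_; _++_; [_]; length; map; concatMap; filter; allFin)
import Data.List.Properties as ListP
open import Data.List.Membership.Propositional using (_∈_; _∉_)
open import Data.List.Membership.Propositional.Properties
  using (∈-∃++; ∈-++⁺ˡ; ∈-++⁺ʳ; ∈-++⁻; ∈-map⁺; ∈-map⁻; ∈-allFin; ∈-filter⁺; ∈-filter⁻; ∈-concatMap⁺)
open import Data.List.Relation.Binary.Subset.Propositional using (_⊆_)
open import Data.List.Relation.Unary.Any using (here; there)
import Data.List.Relation.Unary.Any as Any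
import Data.List.Relation.Unary.All as All
import Data.List.Relation.Unary.All.Properties as AllP
open import Data.List.Relation.Unary.AllPairs using (AllPairs; []; _∷_)
import Data.List.Relation.Unary.AllPairs as AllPairs
import Data.List.Relation.Unary.AllPairs.Properties as AllPairsP
open import Data.List.Relation.Unary.Unique.Propositional using (Unique)
import Data.List.Relation.Unary.Unique.Propositional.Properties as UniqueP
open import Data.List.Relation.Unary.Linked using (Linked; []; [-]; _∷_)
open import Data.List.Relation.Binary.Disjoint.Propositional using (Disjoint)
open import Data.Product using (∃; _×_; _,_; proj₁; proj₂)
open import Data.Empty using (⊥)
open import Data.Sum using (_⊎_; inj₁; inj₂)
open import Function using (_∘_)
open import Relation.Nullary using (Dec; yes; no; does; contradiction)
open import Relation.Nullary.Decidable using (dec-true; dec-false; ¬?; _→-dec_)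
open import Relation.Unary using (Pred; Decidable)
open import Relation.Binary.PropositionalEquality hiding ([_])

∑ : ∀ {a} {A : Set a} → List A → (A → ℕ) → ℕ
∑ []      f = 0
∑ (z ∷ l) f = f z + ∑ l f

syntax ∑ l (λ z → e) = ∑[ z ∈ l ] e

module _ {a} {A : Set a} where

  ∑-cong : ∀ (l : List A) {f g : A → ℕ} → (∀ {z} → z ∈ l → f z ≡ g z) → ∑ l f ≡ ∑ l g
  ∑-cong []      eq = refl
  ∑-cong (z ∷ l) eq = cong₂ _+_ (eq (here refl)) (∑-cong l (eq ∘ there))

  ∑-mono-≤ : ∀ (l : List A) {f g : A → ℕ} → (∀ {z} → z ∈ l → f z ≤ g z) → ∑ l f ≤ ∑ l g
  ∑-mono-≤ []      le = z≤n
  ∑-mono-≤ (z ∷ l) le = ℕP.+-mono-≤ (le (here refl)) (∑-mono-≤ l (le ∘ there))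

  ∑-*ʳ : ∀ (l : List A) (f : A → ℕ) (K : ℕ) → ∑[ z ∈ l ] (f z * K) ≡ ∑ l f * K
  ∑-*ʳ []      f K = refl
  ∑-*ʳ (z ∷ l) f K = trans (cong (_+_ (f z * K)) (∑-*ʳ l f K)) (sym (ℕP.*-distribʳ-+ K (f z) (∑ l f)))

  ∑-const : ∀ (l : List A) (K : ℕ) → ∑[ z ∈ l ] K ≡ length l * K
  ∑-const []      K = refl
  ∑-const (z ∷ l) K = cong (_+_ K) (∑-const l K)

  ∑-filter-≤ : ∀ {p} {P : Pred A p} (P? : Decidable P) (l : List A) {f g : A → ℕ} →
    (∀ {z} → z ∈ l → P z → f z ≤ g z) → ∑ (filter P? l) f ≤ ∑ l g
  ∑-filter-≤ P? []      le = z≤n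
  ∑-filter-≤ P? (z ∷ l) {g = g} le with P? z
  ... | yes pz = ℕP.+-mono-≤ (le (here refl) pz) (∑-filter-≤ P? l (le ∘ there))
  ... | no _   = ℕP.≤-trans (∑-filter-≤ P? l (le ∘ there)) (ℕP.m≤n+m (∑ l g) (g z))

  length-concatMap : ∀ {b} {B : Set b} (h : A → List B) (l : List A) →
    length (concatMap h l) ≡ ∑[ z ∈ l ] length (h z)
  length-concatMap h []      = refl
  length-concatMap h (z ∷ l) = trans (ListP.length-++ (h z)) (cong (_+_ (length (h z))) (length-concatMap h l))

  ∑-++-∷ : ∀ (l m : List A) {z} (f : A → ℕ) → ∑ (l ++ z ∷ m) f ≡ f z + ∑ (l ++ m) f
  ∑-++-∷ []      m f = refl
  ∑-++-∷ (y ∷ l) m {z} f = trans (cong (_+_ (f y)) (∑-++-∷ l m f)) (x∙yz≈y∙xz (f y) (f z) (∑ (l ++ m) f))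

  length-++-∷ : ∀ (l m : List A) {z} → length (l ++ z ∷ m) ≡ suc (length (l ++ m))
  length-++-∷ []      m = refl
  length-++-∷ (y ∷ l) m = cong suc (length-++-∷ l m)

  ∈-++-∷⁻ : ∀ (l m : List A) {y z} → y ∈ l ++ z ∷ m → y ≢ z → y ∈ l ++ m
  ∈-++-∷⁻ l m y∈ y≢z with ∈-++⁻ l y∈
  ... | inj₁ y∈l         = ∈-++⁺ˡ y∈l
  ... | inj₂ (here y≡z)  = contradiction y≡z y≢z
  ... | inj₂ (there y∈m) = ∈-++⁺ʳ l y∈m

  ∈-++-∷⁺ : ∀ (l m : List A) {y z} → y ∈ l ++ m → y ∈ l ++ z ∷ m
  ∈-++-∷⁺ l m y∈ with ∈-++⁻ l y∈
  ... | inj₁ y∈l = ∈-++⁺ˡ y∈l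
  ... | inj₂ y∈m = ∈-++⁺ʳ l (there y∈m)

  Unique-++-∷⁻ : ∀ (l m : List A) {z} → Unique (l ++ z ∷ m) → z ∉ l ++ m × Unique (l ++ m)
  Unique-++-∷⁻ []      m (z≢m ∷ u) = (λ z∈m → All.lookup z≢m z∈m refl) , u
  Unique-++-∷⁻ (y ∷ l) m (y≢ ∷ u) with Unique-++-∷⁻ l m u
  ... | z∉ , u′ = z∉y∷ , AllP.++⁺ (AllP.++⁻ˡ l y≢) (All.tail (AllP.++⁻ʳ l y≢)) ∷ u′
    where
    z∉y∷ : _ ∉ y ∷ l ++ m
    z∉y∷ (here refl) = All.lookup y≢ (∈-++⁺ʳ l (here refl)) refl
    z∉y∷ (there p)   = z∉ p

  unique-⊆⇒length-≤ : ∀ {l m : List A} → Unique l → l ⊆ m → length l ≤ length m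
  unique-⊆⇒length-≤ {[]}    _          _   = z≤n
  unique-⊆⇒length-≤ {z ∷ l} (z≢l ∷ u) l⊆m with ∈-∃++ (l⊆m (here refl))
  ... | m₁ , m₂ , refl = subst (suc (length l) ≤_) (sym (length-++-∷ m₁ m₂))
          (s≤s (unique-⊆⇒length-≤ u λ y∈l → ∈-++-∷⁻ m₁ m₂ (l⊆m (there y∈l))
                                                        (λ { refl → All.lookup z≢l y∈l refl })))

  ∑-piecewise : ∀ {l cs : List A} → Unique l → Unique cs → cs ⊆ l → (f : A → ℕ) (K : ℕ) →
    (∀ {z} → z ∈ l → z ∉ cs → f z ≡ K) → ∑ l f ≡ ∑ cs f + (length l ∸ length cs) * K
  ∑-piecewise {l} {[]}     _ _ _ f K off = trans (∑-cong l (λ z∈ → off z∈ λ ())) (∑-const l K)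
  ∑-piecewise {l} {c ∷ cs} ul (c≢cs ∷ ucs) cs⊆l f K off with ∈-∃++ (cs⊆l (here refl))
  ... | l₁ , l₂ , refl with Unique-++-∷⁻ l₁ l₂ ul
  ...   | c∉l′ , ul′ = begin
    ∑ (l₁ ++ c ∷ l₂) f
      ≡⟨ ∑-++-∷ l₁ l₂ f ⟩
    f c + ∑ (l₁ ++ l₂) f
      ≡⟨ cong (_+_ (f c)) (∑-piecewise ul′ ucs cs⊆l′ f K off′) ⟩
    f c + (∑ cs f + (length (l₁ ++ l₂) ∸ length cs) * K)
      ≡⟨ sym (ℕP.+-assoc (f c) _ _) ⟩
    f c + ∑ cs f + (length (l₁ ++ l₂) ∸ length cs) * K
      ≡⟨ cong (λ len → f c + ∑ cs f + (len ∸ suc (length cs)) * K) (sym (length-++-∷ l₁ l₂)) ⟩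
    f c + ∑ cs f + (length (l₁ ++ c ∷ l₂) ∸ suc (length cs)) * K ∎
    where
    open ≡-Reasoning
    c≢ : ∀ {y} → y ∈ cs → y ≢ c
    c≢ y∈ refl = All.lookup c≢cs y∈ refl
    cs⊆l′ : cs ⊆ l₁ ++ l₂
    cs⊆l′ y∈ = ∈-++-∷⁻ l₁ l₂ (cs⊆l (there y∈)) (c≢ y∈)
    off′ : ∀ {z} → z ∈ l₁ ++ l₂ → z ∉ cs → f z ≡ K
    off′ {z} z∈ z∉ = off (∈-++-∷⁺ l₁ l₂ z∈) λ { (here refl) → c∉l′ z∈ ; (there p) → z∉ p }

  Unique-++⁻ˡ : ∀ (l : List A) {m} → Unique (l ++ m) → Unique l
  Unique-++⁻ˡ []      _          = []
  Unique-++⁻ˡ (z ∷ l) (z≢ ∷ u) = AllP.++⁻ˡ l z≢ ∷ Unique-++⁻ˡ l u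

  Linked-split : ∀ {r} {R : A → A → Set r} (l : List A) {z m} →
    Linked R (l ++ z ∷ m) → Linked R (l ++ [ z ]) × Linked R (z ∷ m)
  Linked-split []          linked         = [-] , linked
  Linked-split (y ∷ [])    (yz ∷ linked)  = yz ∷ [-] , linked
  Linked-split (y ∷ y′ ∷ l) (yy′ ∷ linked) with Linked-split (y′ ∷ l) linked
  ... | front , back = yy′ ∷ front , back

length-allFin : ∀ n → length (allFin n) ≡ n
length-allFin n = ListP.length-tabulate (λ i → i)

∑-allFin-piecewise : ∀ {x} {cs : List (Fin x)} → Unique cs → (f : Fin x → ℕ) (K : ℕ) →
  (∀ {a} → a ∉ cs → f a ≡ K) → ∑ (allFin x) f ≡ ∑ cs f + (x ∸ length cs) * K
∑-allFin-piecewise {x} {cs} ucs f K off =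
  trans (∑-piecewise (UniqueP.allFin⁺ x) ucs (λ {c} _ → ∈-allFin c) f K (λ _ → off))
        (cong (λ len → ∑ cs f + (len ∸ length cs) * K) (length-allFin x))

adj-sym : ∀ {n} (G : Graph n) {u v} → Adj G u v → Adj G v u
adj-sym G {u} {v} uv = trans (Graph.sym G v u) uv

adj-irrefl : ∀ {n} (G : Graph n) {u v} → Adj G u v → u ≢ v
adj-irrefl G {u} uu refl with trans (sym uu) (irrfl G u)
... | ()

Differ : ∀ {n x} → (Fin n → Fin x) → (Fin n → Fin x) → Set
Differ {n} f g = ∃ λ (i : Fin n) → f i ≢ g i

allMaps-differ : ∀ n x → AllPairs Differ (allMaps n x)
allMaps-differ zero    x = All.[] ∷ []
allMaps-differ (suc n) x =
  AllPairsP.concat⁺ (AllP.map⁺ (All.universal sameHead (allFin x)))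
                    (AllPairsP.map⁺ (AllPairs.map differentHeads (UniqueP.allFin⁺ x)))
  where
  sameHead : ∀ a → AllPairs Differ (map (consF a) (allMaps n x))
  sameHead a = AllPairsP.map⁺ (AllPairs.map (λ { (i , fi≢gi) → suc i , fi≢gi }) (allMaps-differ n x))
  differentHeads : ∀ {a b} → a ≢ b →
    All.All (λ f → All.All (Differ f) (map (consF b) (allMaps n x))) (map (consF a) (allMaps n x))
  differentHeads a≢b = AllP.map⁺ (All.universal (λ _ → AllP.map⁺ (All.universal (λ _ → zero , a≢b) _)) _)

module _ {n x : ℕ} (G : Graph n) where

  chromPoly-≤-codes : (ord : List (Fin n)) → (∀ v → v ∈ ord) → (codes : List (List (Fin x))) →
    (∀ c → Proper G c → map c ord ∈ codes) → chromPoly G x ≤ length codes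
  chromPoly-≤-codes ord complete codes proper⇒∈ =
    subst (_≤ length codes) (ListP.length-map code colourings)
      (unique-⊆⇒length-≤ codes-unique codes-⊆)
    where
    colourings : List (Fin n → Fin x)
    colourings = filter (proper? G) (allMaps n x)
    code : (Fin n → Fin x) → List (Fin x)
    code c = map c ord
    code-injective-on-differ : ∀ {c d} → Differ c d → code c ≢ code d
    code-injective-on-differ {c} {d} (i , ci≢di) eq = ci≢di (lookup-eq ord eq (complete i))
      where
      lookup-eq : ∀ vs → map c vs ≡ map d vs → ∀ {v} → v ∈ vs → c v ≡ d v
      lookup-eq (_ ∷ _)  eq (here refl) = proj₁ (ListP.∷-injective eq)
      lookup-eq (_ ∷ vs) eq (there v∈)  = lookup-eq vs (proj₂ (ListP.∷-injective eq)) v∈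
    codes-unique : Unique (map code colourings)
    codes-unique = AllPairsP.map⁺ (AllPairs.map code-injective-on-differ
                     (AllPairsP.filter⁺ (proper? G) (allMaps-differ n x)))
    codes-⊆ : map code colourings ⊆ codes
    codes-⊆ z∈ with ∈-map⁻ code z∈
    ... | c , c∈ , refl = proper⇒∈ c (proj₂ (∈-filter⁻ (proper? G) {xs = allMaps n x} c∈))

-- Colourings of paths and spiders

-- pathCount x ℓ b counts the x-colourings of the ℓ inner vertices of a path whose two ends are
-- precoloured with equal (b = true) or different (b = false) colours.
pathCount : ℕ → ℕ → Bool → ℕ
pathCount x zero    sameEnds = if sameEnds then 0 else 1
pathCount x (suc ℓ) true     = (x ∸ 1) * pathCount x ℓ false
pathCount x (suc ℓ) false    = pathCount x ℓ true + (x ∸ 2) * pathCount x ℓ false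

-- Colourings of three internally disjoint paths with α, β, γ inner vertices from a common centre
-- to three ends precoloured with three different colours.
spiderCount : ℕ → ℕ → ℕ → ℕ → ℕ
spiderCount x α β γ =
  pathCount x α true  * pathCount x β false * pathCount x γ false +
  pathCount x α false * pathCount x β true  * pathCount x γ false +
  pathCount x α false * pathCount x β false * pathCount x γ true  +
  (x ∸ 3) * (pathCount x α false * pathCount x β false * pathCount x γ false)

module _ {x : ℕ} where

  private
    _≟_ : (a b : Fin x) → Dec (a ≡ b)
    _≟_ = FinP._≟_
    ≟-refl : ∀ a → does (a ≟ a) ≡ true
    ≟-refl a = dec-true (a ≟ a) refl

  ∑-pathCount : ∀ (c₁ c₂ : Fin x) ℓ →
    ∑[ a ∈ allFin x ] (if does (a ≟ c₁) then 0 else pathCount x ℓ (does (a ≟ c₂)))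
      ≡ pathCount x (suc ℓ) (does (c₁ ≟ c₂))
  ∑-pathCount c₁ c₂ ℓ with c₁ ≟ c₂
  ... | yes refl = begin
    ∑ (allFin x) f          ≡⟨ ∑-allFin-piecewise (All.[] ∷ []) f D off ⟩
    f c₁ + 0 + (x ∸ 1) * D  ≡⟨ cong (λ p → p + 0 + (x ∸ 1) * D) f-c₁ ⟩
    (x ∸ 1) * D             ∎
    where
    open ≡-Reasoning
    D : ℕ
    D = pathCount x ℓ false
    f : Fin x → ℕ
    f a = if does (a ≟ c₁) then 0 else pathCount x ℓ (does (a ≟ c₁))
    f-c₁ : f c₁ ≡ 0
    f-c₁ rewrite ≟-refl c₁ = refl
    off : ∀ {a} → a ∉ c₁ ∷ [] → f a ≡ D
    off {a} a∉ rewrite dec-false (a ≟ c₁) (a∉ ∘ here) = refl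
  ... | no c₁≢c₂ = begin
    ∑ (allFin x) f                   ≡⟨ ∑-allFin-piecewise ((c₁≢c₂ All.∷ All.[]) ∷ All.[] ∷ []) f D off ⟩
    f c₁ + (f c₂ + 0) + (x ∸ 2) * D  ≡⟨ cong₂ (λ p q → p + (q + 0) + (x ∸ 2) * D) f-c₁ f-c₂ ⟩
    0 + (S + 0) + (x ∸ 2) * D        ≡⟨ cong (_+ (x ∸ 2) * D) (ℕP.+-identityʳ S) ⟩
    S + (x ∸ 2) * D                  ∎
    where
    open ≡-Reasoning
    S D : ℕ
    S = pathCount x ℓ true
    D = pathCount x ℓ false
    f : Fin x → ℕ
    f a = if does (a ≟ c₁) then 0 else pathCount x ℓ (does (a ≟ c₂))
    f-c₁ : f c₁ ≡ 0
    f-c₁ rewrite ≟-refl c₁ = refl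
    f-c₂ : f c₂ ≡ S
    f-c₂ rewrite dec-false (c₂ ≟ c₁) (c₁≢c₂ ∘ sym) | ≟-refl c₂ = refl
    off : ∀ {a} → a ∉ c₁ ∷ c₂ ∷ [] → f a ≡ D
    off {a} a∉ rewrite dec-false (a ≟ c₁) (a∉ ∘ here) | dec-false (a ≟ c₂) (a∉ ∘ there ∘ here) = refl

  ∑-spiderCount : ∀ {c₁ c₂ c₃ : Fin x} → c₁ ≢ c₂ → c₁ ≢ c₃ → c₂ ≢ c₃ → ∀ α β γ →
    ∑[ a ∈ allFin x ] (pathCount x α (does (a ≟ c₁)) * pathCount x β (does (a ≟ c₂)) * pathCount x γ (does (a ≟ c₃)))
      ≡ spiderCount x α β γ
  ∑-spiderCount {c₁} {c₂} {c₃} c₁≢c₂ c₁≢c₃ c₂≢c₃ α β γ = begin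
    ∑ (allFin x) f
      ≡⟨ ∑-allFin-piecewise distinct f (P α false * P β false * P γ false) off ⟩
    f c₁ + (f c₂ + (f c₃ + 0)) + (x ∸ 3) * (P α false * P β false * P γ false)
      ≡⟨ cong (_+ (x ∸ 3) * (P α false * P β false * P γ false))
           (trans (cong (λ r → f c₁ + (f c₂ + r)) (ℕP.+-identityʳ (f c₃))) (sym (ℕP.+-assoc (f c₁) (f c₂) (f c₃)))) ⟩
    f c₁ + f c₂ + f c₃ + (x ∸ 3) * (P α false * P β false * P γ false)
      ≡⟨ cong (λ p → p + (x ∸ 3) * (P α false * P β false * P γ false)) (cong₂ _+_ (cong₂ _+_ f-c₁ f-c₂) f-c₃) ⟩
    spiderCount x α β γ ∎
    where
    open ≡-Reasoning
    P : ℕ → Bool → ℕ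
    P = pathCount x
    f : Fin x → ℕ
    f a = P α (does (a ≟ c₁)) * P β (does (a ≟ c₂)) * P γ (does (a ≟ c₃))
    distinct : Unique (c₁ ∷ c₂ ∷ c₃ ∷ [])
    distinct = (c₁≢c₂ All.∷ c₁≢c₃ All.∷ All.[]) ∷ (c₂≢c₃ All.∷ All.[]) ∷ All.[] ∷ []
    f-c₁ : f c₁ ≡ P α true * P β false * P γ false
    f-c₁ rewrite ≟-refl c₁ | dec-false (c₁ ≟ c₂) c₁≢c₂ | dec-false (c₁ ≟ c₃) c₁≢c₃ = refl
    f-c₂ : f c₂ ≡ P α false * P β true * P γ false
    f-c₂ rewrite dec-false (c₂ ≟ c₁) (c₁≢c₂ ∘ sym) | ≟-refl c₂ | dec-false (c₂ ≟ c₃) c₂≢c₃ = refl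
    f-c₃ : f c₃ ≡ P α false * P β false * P γ true
    f-c₃ rewrite dec-false (c₃ ≟ c₁) (c₁≢c₃ ∘ sym) | dec-false (c₃ ≟ c₂) (c₂≢c₃ ∘ sym) | ≟-refl c₃ = refl
    off : ∀ {a} → a ∉ c₁ ∷ c₂ ∷ c₃ ∷ [] → f a ≡ P α false * P β false * P γ false
    off {a} a∉ rewrite dec-false (a ≟ c₁) (a∉ ∘ here) | dec-false (a ≟ c₂) (a∉ ∘ there ∘ here)
                     | dec-false (a ≟ c₃) (a∉ ∘ there ∘ there ∘ here) = refl

data Attached {n} (G : Graph n) (S : List (Fin n)) : List (Fin n) → Set where
  []  : Attached G S []
  _∷_ : ∀ {v vs} → (∃ λ u → u ∈ S × Adj G u v) → Attached G (S ++ [ v ]) vs → Attached G S (v ∷ vs)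

module Greedy {n x : ℕ} (G : Graph n) where

  open import Data.List.Membership.DecPropositional (FinP._≟_ {x}) using (_∈?_)

  Partial : Set
  Partial = Fin n → Maybe (Fin x)

  uncoloured : Partial
  uncoloured _ = nothing

  assign : Partial → Fin n → Fin x → Partial
  assign ρ v a u = if does (u FinP.≟ v) then just a else ρ u

  assign-≡ : ∀ ρ v a → assign ρ v a v ≡ just a
  assign-≡ ρ v a rewrite dec-true (v FinP.≟ v) refl = refl

  assign-≢ : ∀ ρ {v} a {u} → u ≢ v → assign ρ v a u ≡ ρ u
  assign-≢ ρ {v} a {u} u≢v rewrite dec-false (u FinP.≟ v) u≢v = refl

  Available : Partial → Fin n → Fin x → Set
  Available ρ v a = ∀ u → Adj G u v → ρ u ≢ just a

  available? : ∀ ρ v → Decidable (Available ρ v)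
  available? ρ v a = FinP.all? λ u → (adj G u v ≟ᵇ true) →-dec ¬? (MaybeP.≡-dec FinP._≟_ (ρ u) (just a))

  extensions : Partial → List (Fin n) → List (List (Fin x))
  extensions ρ []       = [ [] ]
  extensions ρ (v ∷ vs) =
    concatMap (λ a → map (a ∷_) (extensions (assign ρ v a) vs)) (filter (available? ρ v) (allFin x))

  #extensions : Partial → List (Fin n) → ℕ
  #extensions ρ vs = length (extensions ρ vs)

  #extensions-∷ : ∀ ρ v vs →
    #extensions ρ (v ∷ vs) ≡ ∑[ a ∈ filter (available? ρ v) (allFin x) ] #extensions (assign ρ v a) vs
  #extensions-∷ ρ v vs = trans (length-concatMap _ (filter (available? ρ v) (allFin x)))
    (∑-cong (filter (available? ρ v) (allFin x)) λ {a} _ → ListP.length-map (a ∷_) (extensions (assign ρ v a) vs))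

  #extensions-∷-≤ : ∀ {ρ v vs} (g : Fin x → ℕ) →
    (∀ {a} → Available ρ v a → #extensions (assign ρ v a) vs ≤ g a) → #extensions ρ (v ∷ vs) ≤ ∑ (allFin x) g
  #extensions-∷-≤ {ρ} {v} {vs} g bound =
    ℕP.≤-trans (ℕP.≤-reflexive (#extensions-∷ ρ v vs)) (∑-filter-≤ (available? ρ v) (allFin x) (λ _ → bound))

  #extensions-∷-avoiding : ∀ {ρ v vs} {cs : List (Fin x)} → Unique cs → (B : ℕ) →
    (∀ {a} → Available ρ v a → a ∉ cs × #extensions (assign ρ v a) vs ≤ B) →
    #extensions ρ (v ∷ vs) ≤ (x ∸ length cs) * B
  #extensions-∷-avoiding {ρ} {v} {vs} {cs} ucs B bound = begin
    #extensions ρ (v ∷ vs)        ≤⟨ #extensions-∷-≤ {ρ} {v} {vs} g g-bound ⟩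
    ∑ (allFin x) g                ≡⟨ ∑-allFin-piecewise ucs g B off ⟩
    ∑ cs g + (x ∸ length cs) * B  ≡⟨ cong (_+ (x ∸ length cs) * B) ∑-cs ⟩
    (x ∸ length cs) * B           ∎
    where
    open ℕP.≤-Reasoning
    g : Fin x → ℕ
    g a = if does (a ∈? cs) then 0 else B
    g-bound : ∀ {a} → Available ρ v a → #extensions (assign ρ v a) vs ≤ g a
    g-bound {a} av with bound av
    ... | a∉cs , le rewrite dec-false (a ∈? cs) a∉cs = le
    off : ∀ {a} → a ∉ cs → g a ≡ B
    off {a} a∉cs rewrite dec-false (a ∈? cs) a∉cs = refl
    ∑-cs : ∑ cs g ≡ 0
    ∑-cs = trans (∑-cong cs (λ {a} a∈ → cong (if_then 0 else B) (dec-true (a ∈? cs) a∈)))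
                 (trans (∑-const cs 0) (ℕP.*-zeroʳ (length cs)))

  Extends : Partial → (Fin n → Fin x) → Set
  Extends ρ c = ∀ {u a} → ρ u ≡ just a → c u ≡ a

  proper-∈-extensions : ∀ {c} → Proper G c → ∀ {ρ} vs → Extends ρ c → map c vs ∈ extensions ρ vs
  proper-∈-extensions         pc []       ext = here refl
  proper-∈-extensions {c} pc {ρ} (v ∷ vs) ext =
    ∈-concatMap⁺ (λ a → map (a ∷_) (extensions (assign ρ v a) vs))
      (Any.map (λ { refl → ∈-map⁺ (c v ∷_) (proper-∈-extensions pc vs ext′) })
               (∈-filter⁺ (available? ρ v) (∈-allFin (c v)) available))
    where
    available : Available ρ v (c v)
    available u uv ρu≡cv = pc u v uv (ext ρu≡cv)
    ext′ : Extends (assign ρ v (c v)) c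
    ext′ {u} with u FinP.≟ v
    ... | yes refl = just-injective
    ... | no _     = ext

  chromPoly-≤-#extensions : (ord : List (Fin n)) → (∀ v → v ∈ ord) → chromPoly G x ≤ #extensions uncoloured ord
  chromPoly-≤-#extensions ord complete =
    chromPoly-≤-codes G ord complete (extensions uncoloured ord) (λ c pc → proper-∈-extensions pc ord (λ ()))

  data Run : Partial → List (Fin n) → Partial → Set where
    []  : ∀ {ρ} → Run ρ [] ρ
    _∷_ : ∀ {ρ v a vs ρ′} → Available ρ v a → Run (assign ρ v a) vs ρ′ → Run ρ (v ∷ vs) ρ′

  #extensions-++-≤ : ∀ {ρ} vs {ws B} → (∀ {ρ′} → Run ρ vs ρ′ → #extensions ρ′ ws ≤ B) →
    #extensions ρ (vs ++ ws) ≤ #extensions ρ vs * B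
  #extensions-++-≤ [] {B = B} bound = ℕP.≤-trans (bound []) (ℕP.≤-reflexive (sym (ℕP.+-identityʳ B)))
  #extensions-++-≤ {ρ} (v ∷ vs) {ws} {B} bound = begin
    #extensions ρ (v ∷ vs ++ ws)                              ≡⟨ #extensions-∷ ρ v (vs ++ ws) ⟩
    ∑[ a ∈ available ] #extensions (assign ρ v a) (vs ++ ws)  ≤⟨ ∑-mono-≤ available split-rest ⟩
    ∑[ a ∈ available ] (#extensions (assign ρ v a) vs * B)    ≡⟨ ∑-*ʳ available _ B ⟩
    (∑[ a ∈ available ] #extensions (assign ρ v a) vs) * B    ≡⟨ cong (_* B) (sym (#extensions-∷ ρ v vs)) ⟩
    #extensions ρ (v ∷ vs) * B                                ∎
    where
    open ℕP.≤-Reasoning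
    available : List (Fin x)
    available = filter (available? ρ v) (allFin x)
    split-rest : ∀ {a} → a ∈ available → #extensions (assign ρ v a) (vs ++ ws) ≤ #extensions (assign ρ v a) vs * B
    split-rest a∈ = #extensions-++-≤ vs (λ run → bound (proj₂ (∈-filter⁻ (available? ρ v) {xs = allFin x} a∈) ∷ run))

  Run-unchanged : ∀ {ρ vs ρ′} → Run ρ vs ρ′ → ∀ {u} → u ∉ vs → ρ′ u ≡ ρ u
  Run-unchanged []                      u∉ = refl
  Run-unchanged {ρ} (_∷_ {a = a} _ run) u∉ = trans (Run-unchanged run (u∉ ∘ there)) (assign-≢ ρ a (u∉ ∘ here))

  Coloured : Partial → Fin n → Set
  Coloured ρ u = ∃ λ a → ρ u ≡ just a

  assign-coloured : ∀ ρ v a {u} → Coloured ρ u → Coloured (assign ρ v a) u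
  assign-coloured ρ v a {u} (b , ρu≡b) with u FinP.≟ v
  ... | yes refl = a , refl
  ... | no _     = b , ρu≡b

  Run-coloured : ∀ {ρ vs ρ′} → Run ρ vs ρ′ → ∀ {u} → Coloured ρ u → Coloured ρ′ u
  Run-coloured []                          col = col
  Run-coloured {ρ} (_∷_ {v = v} {a = a} _ run) col = Run-coloured run (assign-coloured ρ v a col)

  Run-colours : ∀ {ρ vs ρ′} → Run ρ vs ρ′ → ∀ {u} → u ∈ vs → Coloured ρ′ u
  Run-colours {ρ} (_∷_ {a = a} _ run) (here refl) = Run-coloured run (a , assign-≡ ρ _ a)
  Run-colours (_ ∷ run)                (there u∈)  = Run-colours run u∈

  ProperPartial : Partial → Set
  ProperPartial ρ = ∀ {u v a} → Adj G u v → ρ u ≡ just a → ρ v ≢ just a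

  uncoloured-proper : ProperPartial uncoloured
  uncoloured-proper _ ()

  assign-proper : ∀ {ρ v a} → ProperPartial ρ → Available ρ v a → ProperPartial (assign ρ v a)
  assign-proper {ρ} {v} {a} proper av {u} {w} {b} uw ρ′u ρ′w with u FinP.≟ v | w FinP.≟ v
  ... | yes refl | yes refl = adj-irrefl G uw refl
  ... | yes refl | no _     = av w (adj-sym G uw) (trans ρ′w (sym ρ′u))
  ... | no _     | yes refl = av u uw (trans ρ′u (sym ρ′w))
  ... | no _     | no _     = proper uw ρ′u ρ′w

  Run-proper : ∀ {ρ vs ρ′} → Run ρ vs ρ′ → ProperPartial ρ → ProperPartial ρ′
  Run-proper []         proper = proper
  Run-proper (av ∷ run) proper = Run-proper run (assign-proper proper av)

  private
    does-≟-sym : ∀ (a b : Fin x) → does (a FinP.≟ b) ≡ does (b FinP.≟ a)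
    does-≟-sym a b with a FinP.≟ b | b FinP.≟ a
    ... | yes _    | yes _    = refl
    ... | no _     | no _     = refl
    ... | yes refl | no b≢a   = contradiction refl b≢a
    ... | no a≢b   | yes refl = contradiction refl a≢b

  pathBound : ∀ {ρ e₁ e₂ c₁ c₂} vs → ProperPartial ρ → ρ e₁ ≡ just c₁ → ρ e₂ ≡ just c₂ →
    Linked (Adj G) (e₁ ∷ vs ++ [ e₂ ]) → e₂ ∉ vs →
    #extensions ρ vs ≤ pathCount x (length vs) (does (c₁ FinP.≟ c₂))
  pathBound {c₁ = c₁} {c₂} [] proper ρe₁ ρe₂ (e₁e₂ ∷ _) _
    rewrite dec-false (c₁ FinP.≟ c₂) (λ { refl → proper e₁e₂ ρe₁ ρe₂ }) = ℕP.≤-refl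
  pathBound {ρ} {e₁} {e₂} {c₁} {c₂} (v ∷ vs) proper ρe₁ ρe₂ (e₁v ∷ linked) e₂∉ = begin
    #extensions ρ (v ∷ vs)                               ≤⟨ #extensions-∷-≤ {ρ} {v} {vs} g colour-rest ⟩
    ∑ (allFin x) g                                       ≡⟨ ∑-pathCount c₁ c₂ (length vs) ⟩
    pathCount x (suc (length vs)) (does (c₁ FinP.≟ c₂))  ∎
    where
    open ℕP.≤-Reasoning
    g : Fin x → ℕ
    g a = if does (a FinP.≟ c₁) then 0 else pathCount x (length vs) (does (a FinP.≟ c₂))
    colour-rest : ∀ {a} → Available ρ v a → #extensions (assign ρ v a) vs ≤ g a
    colour-rest {a} av rewrite dec-false (a FinP.≟ c₁) (λ { refl → av e₁ e₁v ρe₁ }) =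
      pathBound vs (assign-proper proper av) (assign-≡ ρ v a) (trans (assign-≢ ρ a (e₂∉ ∘ here)) ρe₂)
        linked (e₂∉ ∘ there)

  cliqueBound : ∀ {ρ} ws {cs : List (Fin x)} → Unique ws → Unique cs →
    (∀ {u v} → u ∈ ws → v ∈ ws → u ≢ v → Adj G u v) →
    (∀ {c v} → c ∈ cs → v ∈ ws → ∃ λ u → u ∉ ws × Adj G u v × ρ u ≡ just c) →
    #extensions ρ ws ≤ fall (x ∸ length cs) (length ws)
  cliqueBound []       _ _ _ _ = ℕP.≤-refl
  cliqueBound {ρ} (v ∷ ws) {cs} (v≢ws ∷ uws) ucs clique used = begin
    #extensions ρ (v ∷ ws)                                    ≤⟨ #extensions-∷-avoiding {ρ} {v} {ws} ucs _ colour-rest ⟩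
    (x ∸ length cs) * fall (x ∸ suc (length cs)) (length ws)  ≡⟨ cong (λ y → (x ∸ length cs) * fall y (length ws)) x∸suc ⟩
    fall (x ∸ length cs) (suc (length ws))                    ∎
    where
    open ℕP.≤-Reasoning
    x∸suc : x ∸ suc (length cs) ≡ x ∸ length cs ∸ 1
    x∸suc = sym (trans (ℕP.∸-+-assoc x (length cs) 1) (cong (x ∸_) (ℕP.+-comm (length cs) 1)))
    v∉ws : v ∉ ws
    v∉ws v∈ = All.lookup v≢ws v∈ refl
    colour-rest : ∀ {a} → Available ρ v a →
      a ∉ cs × #extensions (assign ρ v a) ws ≤ fall (x ∸ suc (length cs)) (length ws)
    colour-rest {a} av = a∉cs , cliqueBound ws uws (All.tabulate a≢cs ∷ ucs) (λ u∈ w∈ → clique (there u∈) (there w∈)) used′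
      where
      a∉cs : a ∉ cs
      a∉cs a∈ with used a∈ (here refl)
      ... | u , _ , uv , ρu≡a = av u uv ρu≡a
      a≢cs : ∀ {c} → c ∈ cs → a ≢ c
      a≢cs c∈ refl = a∉cs c∈
      used′ : ∀ {c w} → c ∈ a ∷ cs → w ∈ ws → ∃ λ u → u ∉ ws × Adj G u w × assign ρ v a u ≡ just c
      used′ (here refl) w∈ = v , v∉ws , clique (here refl) (there w∈) (λ { refl → v∉ws w∈ }) , assign-≡ ρ v a
      used′ (there c∈) w∈ with used c∈ (there w∈)
      ... | u , u∉ , uw , ρu≡c = u , u∉ ∘ there , uw , trans (assign-≢ ρ a (u∉ ∘ here)) ρu≡c

  attachedBound : ∀ {ρ S} vs → Attached G S vs → (∀ {u} → u ∈ S → Coloured ρ u) →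
    #extensions ρ vs ≤ (x ∸ 1) ℕ.^ length vs
  attachedBound []       []                          _        = ℕP.≤-refl
  attachedBound {ρ} {S} (v ∷ vs) ((u , u∈S , uv) ∷ attached) coloured with coloured u∈S
  ... | c , ρu≡c = #extensions-∷-avoiding {ρ} {v} {vs} (All.[] ∷ []) _ colour-rest
    where
    colour-rest : ∀ {a} → Available ρ v a → a ∉ c ∷ [] × #extensions (assign ρ v a) vs ≤ (x ∸ 1) ℕ.^ length vs
    colour-rest {a} av = (λ { (here refl) → av u uv ρu≡c }) , attachedBound vs attached coloured′
      where
      coloured′ : ∀ {z} → z ∈ S ++ [ v ] → Coloured (assign ρ v a) z
      coloured′ z∈ with ∈-++⁻ S z∈
      ... | inj₁ z∈S         = assign-coloured ρ v a (coloured z∈S)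
      ... | inj₂ (here refl) = a , assign-≡ ρ v a

  legsBound : ∀ {ρ w a e₁ e₂ e₃ c₁ c₂ c₃} vs₁ vs₂ vs₃ → ProperPartial ρ → ρ w ≡ just a →
    ρ e₁ ≡ just c₁ → ρ e₂ ≡ just c₂ → ρ e₃ ≡ just c₃ →
    Linked (Adj G) (e₁ ∷ vs₁ ++ [ w ]) → Linked (Adj G) (w ∷ vs₂ ++ [ e₂ ]) → Linked (Adj G) (w ∷ vs₃ ++ [ e₃ ]) →
    w ∉ vs₁ ++ vs₂ → Disjoint (e₂ ∷ e₃ ∷ []) (vs₁ ++ vs₂ ++ vs₃) →
    #extensions ρ (vs₁ ++ vs₂ ++ vs₃) ≤
      pathCount x (length vs₁) (does (c₁ FinP.≟ a)) * pathCount x (length vs₂) (does (a FinP.≟ c₂)) *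
      pathCount x (length vs₃) (does (a FinP.≟ c₃))
  legsBound {ρ} {w} {a} {e₁} {e₂} {e₃} {c₁} {c₂} {c₃} vs₁ vs₂ vs₃ proper ρw ρe₁ ρe₂ ρe₃ linked₁ linked₂ linked₃
            w∉ disjoint = begin
    #extensions ρ (vs₁ ++ vs₂ ++ vs₃)  ≤⟨ #extensions-++-≤ vs₁ legs₂₃ ⟩
    #extensions ρ vs₁ * (N₂ * N₃)      ≤⟨ ℕP.*-monoˡ-≤ _ (pathBound vs₁ proper ρe₁ ρw linked₁ (w∉ ∘ ∈-++⁺ˡ)) ⟩
    N₁ * (N₂ * N₃)                     ≡⟨ sym (ℕP.*-assoc N₁ N₂ N₃) ⟩
    N₁ * N₂ * N₃                       ∎
    where
    open ℕP.≤-Reasoning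
    N₁ N₂ N₃ : ℕ
    N₁ = pathCount x (length vs₁) (does (c₁ FinP.≟ a))
    N₂ = pathCount x (length vs₂) (does (a FinP.≟ c₂))
    N₃ = pathCount x (length vs₃) (does (a FinP.≟ c₃))
    e₂∉ : e₂ ∉ vs₁ ++ vs₂ ++ vs₃
    e₂∉ e₂∈ = disjoint (here refl , e₂∈)
    e₃∉ : e₃ ∉ vs₁ ++ vs₂ ++ vs₃
    e₃∉ e₃∈ = disjoint (there (here refl) , e₃∈)
    legs₂₃ : ∀ {ρ₂} → Run ρ vs₁ ρ₂ → #extensions ρ₂ (vs₂ ++ vs₃) ≤ N₂ * N₃
    legs₂₃ {ρ₂} run₁ = ℕP.≤-trans (#extensions-++-≤ vs₂ leg₃)
      (ℕP.*-monoˡ-≤ _ (pathBound vs₂ proper₂ ρ₂w (ρ₂-unchanged e₂∉ ρe₂) linked₂ (e₂∉ ∘ ∈-++⁺ʳ vs₁ ∘ ∈-++⁺ˡ)))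
      where
      proper₂ : ProperPartial ρ₂
      proper₂ = Run-proper run₁ proper
      ρ₂-unchanged : ∀ {e c} → e ∉ vs₁ ++ vs₂ ++ vs₃ → ρ e ≡ just c → ρ₂ e ≡ just c
      ρ₂-unchanged e∉ ρe = trans (Run-unchanged run₁ (e∉ ∘ ∈-++⁺ˡ)) ρe
      ρ₂w : ρ₂ w ≡ just a
      ρ₂w = trans (Run-unchanged run₁ (w∉ ∘ ∈-++⁺ˡ)) ρw
      leg₃ : ∀ {ρ₃} → Run ρ₂ vs₂ ρ₃ → #extensions ρ₃ vs₃ ≤ N₃
      leg₃ run₂ = pathBound vs₃ (Run-proper run₂ proper₂)
        (trans (Run-unchanged run₂ (w∉ ∘ ∈-++⁺ʳ vs₁)) ρ₂w)
        (trans (Run-unchanged run₂ (e₃∉ ∘ ∈-++⁺ʳ vs₁ ∘ ∈-++⁺ˡ)) (ρ₂-unchanged e₃∉ ρe₃))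
        linked₃ (e₃∉ ∘ ∈-++⁺ʳ vs₁ ∘ ∈-++⁺ʳ vs₂)

  -- The first leg is listed from its foot, the other two from the centre.
  spiderBound : ∀ {ρ w e₁ e₂ e₃ c₁ c₂ c₃} vs₁ vs₂ vs₃ → ProperPartial ρ →
    ρ e₁ ≡ just c₁ → ρ e₂ ≡ just c₂ → ρ e₃ ≡ just c₃ → c₁ ≢ c₂ → c₁ ≢ c₃ → c₂ ≢ c₃ →
    Linked (Adj G) (e₁ ∷ vs₁ ++ [ w ]) → Linked (Adj G) (w ∷ vs₂ ++ [ e₂ ]) → Linked (Adj G) (w ∷ vs₃ ++ [ e₃ ]) →
    w ∉ vs₁ ++ vs₂ → Disjoint (e₁ ∷ e₂ ∷ e₃ ∷ []) (w ∷ vs₁ ++ vs₂ ++ vs₃) →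
    #extensions ρ (w ∷ vs₁ ++ vs₂ ++ vs₃) ≤ spiderCount x (length vs₁) (length vs₂) (length vs₃)
  spiderBound {ρ} {w} {e₁} {e₂} {e₃} {c₁} {c₂} {c₃} vs₁ vs₂ vs₃ proper ρe₁ ρe₂ ρe₃ c₁≢c₂ c₁≢c₃ c₂≢c₃
              linked₁ linked₂ linked₃ w∉ disjoint = begin
    #extensions ρ (w ∷ vs₁ ++ vs₂ ++ vs₃)
      ≤⟨ #extensions-∷-≤ {ρ} {w} {vs₁ ++ vs₂ ++ vs₃} g colour-legs ⟩
    ∑ (allFin x) g
      ≡⟨ ∑-spiderCount c₁≢c₂ c₁≢c₃ c₂≢c₃ (length vs₁) (length vs₂) (length vs₃) ⟩
    spiderCount x (length vs₁) (length vs₂) (length vs₃) ∎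
    where
    open ℕP.≤-Reasoning
    g : Fin x → ℕ
    g a = pathCount x (length vs₁) (does (a FinP.≟ c₁)) * pathCount x (length vs₂) (does (a FinP.≟ c₂)) *
          pathCount x (length vs₃) (does (a FinP.≟ c₃))
    foot≢w : ∀ {e} → e ∈ e₁ ∷ e₂ ∷ e₃ ∷ [] → e ≢ w
    foot≢w e∈ refl = disjoint (e∈ , here refl)
    colour-legs : ∀ {a} → Available ρ w a → #extensions (assign ρ w a) (vs₁ ++ vs₂ ++ vs₃) ≤ g a
    colour-legs {a} av =
      subst (λ b → #extensions (assign ρ w a) (vs₁ ++ vs₂ ++ vs₃) ≤ pathCount x (length vs₁) b * _ * _)
        (does-≟-sym c₁ a)
        (legsBound vs₁ vs₂ vs₃ (assign-proper proper av) (assign-≡ ρ w a)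
          (trans (assign-≢ ρ a (foot≢w (here refl))) ρe₁)
          (trans (assign-≢ ρ a (foot≢w (there (here refl)))) ρe₂)
          (trans (assign-≢ ρ a (foot≢w (there (there (here refl))))) ρe₃)
          linked₁ linked₂ linked₃ w∉ λ (e∈ , z∈) → disjoint (there e∈ , there z∈))

module _ {n} (G : Graph n) where

  open import Data.List.Membership.DecPropositional (FinP._≟_ {n}) using (_∈?_)

  exitEdge : ∀ {X s v} → Reach G X s v → ∀ {S} → s ∈ S → v ∉ S →
    ∃ λ u → ∃ λ v′ → u ∈ S × v′ ∉ S × Adj G u v′
  exitEdge (here _)              s∈ v∉ = contradiction s∈ v∉
  exitEdge (step {v = v′} _ uv r) {S} s∈ v∉ with v′ ∈? S
  ... | yes v′∈ = exitEdge r v′∈ v∉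
  ... | no v′∉  = _ , v′ , s∈ , v′∉ , uv

  AttachedCompletion : List (Fin n) → Set
  AttachedCompletion S = ∃ λ rest → Attached G S rest × Unique (S ++ rest) × (∀ v → v ∈ S ++ rest)

  private
    -- With no fuel left, n ≤ length S forces S to contain every vertex.
    attachWithFuel : ConnectedMinus G (λ _ → ⊥) → ∀ fuel {s} S → s ∈ S → Unique S → n ≤ fuel + length S →
      AttachedCompletion S
    attachWithFuel conn fuel S s∈ uS bound with FinP.any? (λ v → ¬? (v ∈? S))
    ... | no none = [] , [] , subst Unique (sym (ListP.++-identityʳ S)) uS ,
                    λ v → subst (v ∈_) (sym (ListP.++-identityʳ S)) (in-S v)
      where
      in-S : ∀ v → v ∈ S
      in-S v with v ∈? S
      ... | yes v∈ = v∈
      ... | no v∉  = contradiction (v , v∉) none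
    ... | yes (v₀ , v₀∉) with exitEdge (conn _ v₀ (λ ()) (λ ())) s∈ v₀∉
    ...   | u , v , u∈ , v∉ , uv with fuel
    ...     | zero = contradiction bound (ℕP.<⇒≱ (ℕP.≤-trans
                       (unique-⊆⇒length-≤ {m = allFin n} (AllP.¬Any⇒All¬ S v₀∉ ∷ uS) (λ {z} _ → ∈-allFin z))
                       (ℕP.≤-reflexive (length-allFin n))))
    ...     | suc fuel′ with attachWithFuel conn fuel′ (S ++ [ v ]) (∈-++⁺ˡ s∈) uS+v bound′
      where
      uS+v : Unique (S ++ [ v ])
      uS+v = UniqueP.++⁺ uS (All.[] ∷ []) λ { (v∈ , here refl) → v∉ v∈ }
      bound′ : n ≤ fuel′ + length (S ++ [ v ])
      bound′ = subst (n ≤_) (trans (sym (ℕP.+-suc fuel′ (length S)))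
                 (cong (_+_ fuel′) (trans (ℕP.+-comm 1 (length S)) (sym (ListP.length-++ S))))) bound
    ...       | rest , attached , unique , complete =
      v ∷ rest , (u , u∈ , uv) ∷ attached ,
      subst Unique (ListP.++-assoc S [ v ] rest) unique ,
      λ z → subst (z ∈_) (ListP.++-assoc S [ v ] rest) (complete z)

  attachedCompletion : ConnectedMinus G (λ _ → ⊥) → ∀ {s} S → s ∈ S → Unique S → AttachedCompletion S
  attachedCompletion conn S s∈ uS = attachWithFuel conn n S s∈ uS (ℕP.m≤m+n n (length S))

module ThetaCount {n k x : ℕ} (G : Graph n) (conn : ConnectedMinus G (λ _ → ⊥)) (θ : ThetaClique G k) where

  open ThetaClique θ
  open Greedy {n} {x} G

  private
    I1-split : ∃ λ ys → ∃ λ zs → I1 ≡ ys ++ [ w ] ++ zs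
    I1-split = ∈-∃++ w∈I1

  pre post : List (Fin n)
  pre  = proj₁ I1-split
  post = proj₁ (proj₂ I1-split)

  I1≡pre++w∷post : I1 ≡ pre ++ w ∷ post
  I1≡pre++w∷post = proj₂ (proj₂ I1-split)

  K : List (Fin n)
  K = map f (allFin k)

  spider : List (Fin n)
  spider = w ∷ pre ++ post ++ I2

  f∈K : ∀ i → f i ∈ K
  f∈K i = ∈-map⁺ f (∈-allFin i)

  unique-K : Unique K
  unique-K = UniqueP.map⁺ (f-inj _ _) (UniqueP.allFin⁺ k)

  K-adjacent : ∀ {u v} → u ∈ K → v ∈ K → u ≢ v → Adj G u v
  K-adjacent u∈ v∈ u≢v with ∈-map⁻ f u∈ | ∈-map⁻ f v∈
  ... | i , _ , refl | j , _ , refl = clique i j (λ { refl → u≢v refl })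

  pre++post⊆I1 : pre ++ post ⊆ I1
  pre++post⊆I1 = subst (_ ∈_) (sym I1≡pre++w∷post) ∘ ∈-++-∷⁺ pre post

  spider⊆I1∪I2 : ∀ {z} → z ∈ spider → z ∈ I1 ⊎ z ∈ I2
  spider⊆I1∪I2 (here refl) = inj₁ w∈I1
  spider⊆I1∪I2 (there z∈) with ∈-++⁻ (pre ++ post) (subst (_ ∈_) (sym (ListP.++-assoc pre post I2)) z∈)
  ... | inj₁ z∈pp = inj₁ (pre++post⊆I1 z∈pp)
  ... | inj₂ z∈I2 = inj₂ z∈I2

  I1∩I2=∅ : ∀ {z} → z ∈ I1 → z ∉ I2
  I1∩I2=∅ z∈I1 z∈I2 = proj₂ (I2-new _ z∈I2) (there (∈-++⁺ˡ z∈I1))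

  spider-new : ∀ {z} → z ∈ spider → NotInClique f z
  spider-new z∈ with spider⊆I1∪I2 z∈
  ... | inj₁ z∈I1 = I1-new _ z∈I1
  ... | inj₂ z∈I2 = proj₁ (I2-new _ z∈I2)

  K∩spider=∅ : ∀ {z} → z ∈ K → z ∉ spider
  K∩spider=∅ z∈K z∈ with ∈-map⁻ f z∈K
  ... | i , _ , refl = spider-new z∈ i refl

  w∉pre++post : w ∉ pre ++ post
  w∉pre++post = proj₁ (Unique-++-∷⁻ pre post unique-I1)
    where
    unique-I1 : Unique (pre ++ w ∷ post)
    unique-I1 with proj₁ Q1-path
    ... | _ ∷ u = subst Unique I1≡pre++w∷post (Unique-++⁻ˡ I1 u)

  unique-spider : Unique spider
  unique-spider = AllP.¬Any⇒All¬ _ w∉ ∷ subst Unique (ListP.++-assoc pre post I2)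
                    (UniqueP.++⁺ unique-pre++post unique-I2 λ (p , q) → I1∩I2=∅ (pre++post⊆I1 p) q)
    where
    unique-pre++post : Unique (pre ++ post)
    unique-pre++post with proj₁ Q1-path
    ... | _ ∷ u = proj₂ (Unique-++-∷⁻ pre post (subst Unique I1≡pre++w∷post (Unique-++⁻ˡ I1 u)))
    unique-I2 : Unique I2
    unique-I2 with proj₁ Q2-path
    ... | _ ∷ u = Unique-++⁻ˡ I2 u
    w∉ : w ∉ pre ++ post ++ I2
    w∉ w∈ with ∈-++⁻ (pre ++ post) (subst (_ ∈_) (sym (ListP.++-assoc pre post I2)) w∈)
    ... | inj₁ w∈pp = w∉pre++post w∈pp
    ... | inj₂ w∈I2 = I1∩I2=∅ w∈I1 w∈I2

  legs₁₂ : Linked (Adj G) (f a ∷ pre ++ [ w ]) × Linked (Adj G) (w ∷ post ++ [ f b ])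
  legs₁₂ = Linked-split (f a ∷ pre)
    (subst (λ l → Linked (Adj G) (f a ∷ l)) (trans (cong (_++ [ f b ]) I1≡pre++w∷post)
                                                  (ListP.++-assoc pre (w ∷ post) [ f b ])) (proj₂ Q1-path))

  length-I2≥1 : 1 ≤ length I2
  length-I2≥1 = nonempty I2 {w} {f c} Q2-len
    where
    nonempty : ∀ (l : List (Fin n)) {y z} → 3 ≤ length (y ∷ l ++ [ z ]) → 1 ≤ length l
    nonempty []      (s≤s (s≤s ()))
    nonempty (_ ∷ _) _ = s≤s z≤n

  private
    completion : AttachedCompletion G (K ++ spider)
    completion = attachedCompletion G conn (K ++ spider) (∈-++⁺ˡ (f∈K a))
                   (UniqueP.++⁺ unique-K unique-spider λ (p , q) → K∩spider=∅ p q)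

  rest : List (Fin n)
  rest = proj₁ completion

  ord : List (Fin n)
  ord = K ++ spider ++ rest

  length-K : length K ≡ k
  length-K = trans (ListP.length-map f (allFin k)) (length-allFin k)

  length-spider : length spider ≡ suc (length pre + length post + length I2)
  length-spider = cong suc (trans (ListP.length-++ pre)
    (trans (cong (_+_ (length pre)) (ListP.length-++ post)) (sym (ℕP.+-assoc (length pre) _ _))))

  length-bound : k + suc (length pre + length post + length I2) + length rest ≤ n
  length-bound = begin
    k + suc (length pre + length post + length I2) + length rest
      ≡⟨ ℕP.+-assoc k _ (length rest) ⟩
    k + (suc (length pre + length post + length I2) + length rest)
      ≡⟨ sym (cong₂ (λ p q → p + (q + length rest)) length-K length-spider) ⟩
    length K + (length spider + length rest)
      ≡⟨ sym (trans (ListP.length-++ K) (cong (_+_ (length K)) (ListP.length-++ spider))) ⟩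
    length ord
      ≤⟨ unique-⊆⇒length-≤ ord-unique (λ {z} _ → ∈-allFin z) ⟩
    length (allFin n)
      ≡⟨ length-allFin n ⟩
    n ∎
    where
    open ℕP.≤-Reasoning
    ord-unique : Unique ord
    ord-unique = subst Unique (ListP.++-assoc K spider rest) (proj₁ (proj₂ (proj₂ completion)))

  ord-complete : ∀ v → v ∈ ord
  ord-complete v = subst (v ∈_) (ListP.++-assoc K spider rest) (proj₂ (proj₂ (proj₂ completion)) v)

  K-bound : #extensions uncoloured K ≤ fall x k
  K-bound = subst (λ len → #extensions uncoloured K ≤ fall x len) length-K
              (cliqueBound K unique-K [] K-adjacent λ ())

  spider-bound : ∀ {ρ₁} → Run uncoloured K ρ₁ →
    #extensions ρ₁ spider ≤ spiderCount x (length pre) (length post) (length I2)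
  spider-bound {ρ₁} run₁ = spiderBound pre post I2 proper₁ (proj₂ (foot a)) (proj₂ (foot b)) (proj₂ (foot c))
    (distinct a≢b) (distinct (c≢a ∘ sym)) (distinct (c≢b ∘ sym))
    (proj₁ legs₁₂) (proj₂ legs₁₂) (proj₂ Q2-path) w∉pre++post feet∩spider=∅
    where
    proper₁ : ProperPartial ρ₁
    proper₁ = Run-proper run₁ uncoloured-proper
    foot : ∀ i → Coloured ρ₁ (f i)
    foot i = Run-colours run₁ (f∈K i)
    distinct : ∀ {i j} → i ≢ j → proj₁ (foot i) ≢ proj₁ (foot j)
    distinct {i} {j} i≢j eq = proper₁ (clique i j i≢j) (proj₂ (foot i)) (trans (proj₂ (foot j)) (cong just (sym eq)))
    feet∩spider=∅ : Disjoint (f a ∷ f b ∷ f c ∷ []) spider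
    feet∩spider=∅ (here refl , z∈)                 = spider-new z∈ a refl
    feet∩spider=∅ (there (here refl) , z∈)         = spider-new z∈ b refl
    feet∩spider=∅ (there (there (here refl)) , z∈) = spider-new z∈ c refl

  rest-bound : ∀ {ρ₁ ρ₂} → Run uncoloured K ρ₁ → Run ρ₁ spider ρ₂ → #extensions ρ₂ rest ≤ (x ∸ 1) ℕ.^ length rest
  rest-bound {ρ₂ = ρ₂} run₁ run₂ = attachedBound rest (proj₁ (proj₂ completion)) coloured
    where
    coloured : ∀ {u} → u ∈ K ++ spider → Coloured ρ₂ u
    coloured u∈ with ∈-++⁻ K u∈
    ... | inj₁ u∈K = Run-coloured run₂ (Run-colours run₁ u∈K)
    ... | inj₂ u∈S = Run-colours run₂ u∈S

  chromPoly-bound : chromPoly G x ≤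
    fall x k * (spiderCount x (length pre) (length post) (length I2) * (x ∸ 1) ℕ.^ length rest)
  chromPoly-bound = begin
    chromPoly G x                                 ≤⟨ chromPoly-≤-#extensions ord ord-complete ⟩
    #extensions uncoloured (K ++ spider ++ rest)  ≤⟨ #extensions-++-≤ K spider-and-rest ⟩
    #extensions uncoloured K * (E * y^r)          ≤⟨ ℕP.*-monoˡ-≤ _ K-bound ⟩
    fall x k * (E * y^r)                          ∎
    where
    open ℕP.≤-Reasoning
    E y^r : ℕ
    E = spiderCount x (length pre) (length post) (length I2)
    y^r = (x ∸ 1) ℕ.^ length rest
    spider-and-rest : ∀ {ρ₁} → Run uncoloured K ρ₁ → #extensions ρ₁ (spider ++ rest) ≤ E * y^r
    spider-and-rest run₁ = ℕP.≤-trans (#extensions-++-≤ spider (rest-bound run₁)) (ℕP.*-monoˡ-≤ _ (spider-bound run₁))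

-- Arithmetic of path counts

σ : ℕ → ℤ
σ ℓ = -1ℤ ^ ℓ

σ-cases : ∀ ℓ → σ ℓ ≡ 1ℤ ⊎ σ ℓ ≡ -1ℤ
σ-cases zero    = inj₁ refl
σ-cases (suc ℓ) with σ-cases ℓ
... | inj₁ eq = inj₂ (cong (-1ℤ *ℤ_) eq)
... | inj₂ eq = inj₁ (cong (-1ℤ *ℤ_) eq)

σ-suc-+ : ∀ a b → σ (suc (a + b)) ≡ -1ℤ *ℤ (σ a *ℤ σ b)
σ-suc-+ a b = cong (-1ℤ *ℤ_) (ℤP.^-distribˡ-+-* -1ℤ a b)

signed-sum⇒≤ : ∀ ℓ {A B P : ℕ} → + A +ℤ σ ℓ *ℤ + P ≡ + B → B ≤ A + P
signed-sum⇒≤ ℓ {A} {B} {P} eq with σ-cases ℓ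
... | inj₁ σ≡1 = ℕP.≤-reflexive (ℤP.+-injective (sym (begin
      + (A + P)          ≡⟨ ℤP.pos-+ A P ⟩
      + A +ℤ + P         ≡⟨ cong (+ A +ℤ_) (sym (ℤP.*-identityˡ (+ P))) ⟩
      + A +ℤ 1ℤ *ℤ + P   ≡⟨ cong (λ s → + A +ℤ s *ℤ + P) (sym σ≡1) ⟩
      + A +ℤ σ ℓ *ℤ + P  ≡⟨ eq ⟩
      + B                ∎)))
  where open ≡-Reasoning
... | inj₂ σ≡-1 = ℕP.≤-trans (ℕP.m≤m+n B P) (ℕP.≤-trans (ℕP.≤-reflexive (ℤP.+-injective (begin
      + (B + P)                 ≡⟨ ℤP.pos-+ B P ⟩
      + B +ℤ + P                ≡⟨ cong (λ b → b +ℤ + P) (sym eq) ⟩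
      + A +ℤ σ ℓ *ℤ + P +ℤ + P  ≡⟨ cong (λ s → + A +ℤ s *ℤ + P +ℤ + P) σ≡-1 ⟩
      + A +ℤ -1ℤ *ℤ + P +ℤ + P  ≡⟨ cancel (+ A) (+ P) ⟩
      + A                       ∎))) (ℕP.m≤m+n A P))
  where
  open ≡-Reasoning
  cancel : ∀ a p → a +ℤ -1ℤ *ℤ p +ℤ p ≡ a
  cancel = solve-∀

module PathCounts (t : ℕ) where

  x : ℕ
  x = 2 + t

  D S : ℕ → ℤ
  D ℓ = + pathCount x ℓ false
  S ℓ = + pathCount x ℓ true

  Y : ℤ
  Y = + (x ∸ 1)

  +x≡Y+1 : + x ≡ Y +ℤ 1ℤ
  +x≡Y+1 = trans (cong +_ (ℕP.+-comm 1 (x ∸ 1))) (ℤP.pos-+ (x ∸ 1) 1)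

  S-suc : ∀ ℓ → S (suc ℓ) ≡ Y *ℤ D ℓ
  S-suc ℓ = ℤP.pos-* (x ∸ 1) (pathCount x ℓ false)

  D-suc-S : ∀ ℓ → D (suc ℓ) ≡ S ℓ +ℤ (Y -ℤ 1ℤ) *ℤ D ℓ
  D-suc-S ℓ = begin
    + (pathCount x ℓ true + t * pathCount x ℓ false)  ≡⟨ ℤP.pos-+ (pathCount x ℓ true) _ ⟩
    S ℓ +ℤ + (t * pathCount x ℓ false)                ≡⟨ cong (S ℓ +ℤ_) (ℤP.pos-* t _) ⟩
    S ℓ +ℤ + t *ℤ D ℓ                                 ≡⟨ cong (λ T → S ℓ +ℤ T *ℤ D ℓ) +t≡Y-1 ⟩
    S ℓ +ℤ (Y -ℤ 1ℤ) *ℤ D ℓ                           ∎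
    where
    open ≡-Reasoning
    +t≡Y-1 : + t ≡ Y -ℤ 1ℤ
    +t≡Y-1 = trans (add-sub (+ t)) (cong (_-ℤ 1ℤ) (sym (ℤP.pos-+ 1 t)))
      where
      add-sub : ∀ T → T ≡ (1ℤ +ℤ T) -ℤ 1ℤ
      add-sub = solve-∀

  S+σ≡D : ∀ ℓ → S ℓ +ℤ σ ℓ ≡ D ℓ
  S+σ≡D zero    = refl
  S+σ≡D (suc ℓ) = begin
    S (suc ℓ) +ℤ σ (suc ℓ)            ≡⟨ cong (_+ℤ σ (suc ℓ)) (S-suc ℓ) ⟩
    Y *ℤ D ℓ +ℤ -1ℤ *ℤ σ ℓ            ≡⟨ cong (λ d → Y *ℤ d +ℤ -1ℤ *ℤ σ ℓ) (sym (S+σ≡D ℓ)) ⟩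
    Y *ℤ (S ℓ +ℤ σ ℓ) +ℤ -1ℤ *ℤ σ ℓ   ≡⟨ rearrange Y (S ℓ) (σ ℓ) ⟩
    S ℓ +ℤ (Y -ℤ 1ℤ) *ℤ (S ℓ +ℤ σ ℓ)  ≡⟨ cong (λ d → S ℓ +ℤ (Y -ℤ 1ℤ) *ℤ d) (S+σ≡D ℓ) ⟩
    S ℓ +ℤ (Y -ℤ 1ℤ) *ℤ D ℓ           ≡⟨ sym (D-suc-S ℓ) ⟩
    D (suc ℓ)                         ∎
    where
    open ≡-Reasoning
    rearrange : ∀ y s σ → y *ℤ (s +ℤ σ) +ℤ -1ℤ *ℤ σ ≡ s +ℤ (y -ℤ 1ℤ) *ℤ (s +ℤ σ)
    rearrange = solve-∀

  S≡D-σ : ∀ ℓ → S ℓ ≡ D ℓ -ℤ σ ℓ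
  S≡D-σ ℓ = trans (add-sub (S ℓ) (σ ℓ)) (cong (_-ℤ σ ℓ) (S+σ≡D ℓ))
    where
    add-sub : ∀ s σ → s ≡ (s +ℤ σ) -ℤ σ
    add-sub = solve-∀

  D-suc : ∀ ℓ → D (suc ℓ) ≡ Y *ℤ D ℓ -ℤ σ ℓ
  D-suc ℓ = begin
    D (suc ℓ)                       ≡⟨ D-suc-S ℓ ⟩
    S ℓ +ℤ (Y -ℤ 1ℤ) *ℤ D ℓ         ≡⟨ cong (λ s → s +ℤ (Y -ℤ 1ℤ) *ℤ D ℓ) (S≡D-σ ℓ) ⟩
    D ℓ -ℤ σ ℓ +ℤ (Y -ℤ 1ℤ) *ℤ D ℓ  ≡⟨ rearrange Y (D ℓ) (σ ℓ) ⟩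
    Y *ℤ D ℓ -ℤ σ ℓ                 ∎
    where
    open ≡-Reasoning
    rearrange : ∀ y d σ → d -ℤ σ +ℤ (y -ℤ 1ℤ) *ℤ d ≡ y *ℤ d -ℤ σ
    rearrange = solve-∀

  -- Gluing two paths at a new middle vertex.
  D-concat : ∀ a b → D (suc (a + b)) ≡ (Y +ℤ 1ℤ) *ℤ D a *ℤ D b -ℤ σ a *ℤ D b -ℤ σ b *ℤ D a
  D-concat zero    b = trans (D-suc b) (rearrange Y (D b) (σ b))
    where
    rearrange : ∀ y d σ → y *ℤ d -ℤ σ ≡ (y +ℤ 1ℤ) *ℤ 1ℤ *ℤ d -ℤ 1ℤ *ℤ d -ℤ σ *ℤ 1ℤ
    rearrange = solve-∀
  D-concat (suc a) b = begin
    D (suc (suc (a + b)))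
      ≡⟨ D-suc (suc (a + b)) ⟩
    Y *ℤ D (suc (a + b)) -ℤ σ (suc (a + b))
      ≡⟨ cong₂ (λ d s → Y *ℤ d -ℤ s) (D-concat a b) (σ-suc-+ a b) ⟩
    Y *ℤ ((Y +ℤ 1ℤ) *ℤ D a *ℤ D b -ℤ σ a *ℤ D b -ℤ σ b *ℤ D a) -ℤ -1ℤ *ℤ (σ a *ℤ σ b)
      ≡⟨ rearrange Y (D a) (D b) (σ a) (σ b) ⟩
    (Y +ℤ 1ℤ) *ℤ (Y *ℤ D a -ℤ σ a) *ℤ D b -ℤ -1ℤ *ℤ σ a *ℤ D b -ℤ σ b *ℤ (Y *ℤ D a -ℤ σ a)
      ≡⟨ cong (λ d → (Y +ℤ 1ℤ) *ℤ d *ℤ D b -ℤ -1ℤ *ℤ σ a *ℤ D b -ℤ σ b *ℤ d) (sym (D-suc a)) ⟩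
    (Y +ℤ 1ℤ) *ℤ D (suc a) *ℤ D b -ℤ σ (suc a) *ℤ D b -ℤ σ b *ℤ D (suc a) ∎
    where
    open ≡-Reasoning
    rearrange : ∀ y da db σa σb →
      y *ℤ ((y +ℤ 1ℤ) *ℤ da *ℤ db -ℤ σa *ℤ db -ℤ σb *ℤ da) -ℤ -1ℤ *ℤ (σa *ℤ σb)
        ≡ (y +ℤ 1ℤ) *ℤ (y *ℤ da -ℤ σa) *ℤ db -ℤ -1ℤ *ℤ σa *ℤ db -ℤ σb *ℤ (y *ℤ da -ℤ σa)
    rearrange = solve-∀

  x*D≡Y^+σ : ∀ m → + x *ℤ D m ≡ Y ^ suc m +ℤ σ m
  x*D≡Y^+σ zero = trans (cong (_*ℤ 1ℤ) +x≡Y+1) (rearrange Y)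
    where
    rearrange : ∀ y → (y +ℤ 1ℤ) *ℤ 1ℤ ≡ y *ℤ 1ℤ +ℤ 1ℤ
    rearrange = solve-∀
  x*D≡Y^+σ (suc m) = begin
    + x *ℤ D (suc m)                             ≡⟨ cong₂ _*ℤ_ +x≡Y+1 (D-suc m) ⟩
    (Y +ℤ 1ℤ) *ℤ (Y *ℤ D m -ℤ σ m)               ≡⟨ rearrange₁ Y (D m) (σ m) ⟩
    Y *ℤ ((Y +ℤ 1ℤ) *ℤ D m) -ℤ (Y +ℤ 1ℤ) *ℤ σ m  ≡⟨ cong (λ z → Y *ℤ (z *ℤ D m) -ℤ (Y +ℤ 1ℤ) *ℤ σ m) (sym +x≡Y+1) ⟩
    Y *ℤ (+ x *ℤ D m) -ℤ (Y +ℤ 1ℤ) *ℤ σ m        ≡⟨ cong (λ z → Y *ℤ z -ℤ (Y +ℤ 1ℤ) *ℤ σ m) (x*D≡Y^+σ m) ⟩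
    Y *ℤ (Y ^ suc m +ℤ σ m) -ℤ (Y +ℤ 1ℤ) *ℤ σ m  ≡⟨ rearrange₂ Y (Y ^ suc m) (σ m) ⟩
    Y *ℤ Y ^ suc m +ℤ -1ℤ *ℤ σ m                 ∎
    where
    open ≡-Reasoning
    rearrange₁ : ∀ y d σ → (y +ℤ 1ℤ) *ℤ (y *ℤ d -ℤ σ) ≡ y *ℤ ((y +ℤ 1ℤ) *ℤ d) -ℤ (y +ℤ 1ℤ) *ℤ σ
    rearrange₁ = solve-∀
    rearrange₂ : ∀ y p σ → y *ℤ (p +ℤ σ) -ℤ (y +ℤ 1ℤ) *ℤ σ ≡ y *ℤ p +ℤ -1ℤ *ℤ σ
    rearrange₂ = solve-∀

  x*F*D-closedForm : ∀ F m → + (x * F * pathCount x m false) ≡ + F *ℤ (Y ^ (m + 1) +ℤ σ m)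
  x*F*D-closedForm F m = begin
    + (x * F * pathCount x m false)    ≡⟨ cong +_ (trans (cong (_* pathCount x m false) (ℕP.*-comm x F)) (ℕP.*-assoc F x _)) ⟩
    + (F * (x * pathCount x m false))  ≡⟨ trans (ℤP.pos-* F _) (cong (+ F *ℤ_) (ℤP.pos-* x (pathCount x m false))) ⟩
    + F *ℤ (+ x *ℤ D m)                ≡⟨ cong (+ F *ℤ_) (x*D≡Y^+σ m) ⟩
    + F *ℤ (Y ^ suc m +ℤ σ m)          ≡⟨ cong (λ e → + F *ℤ (Y ^ e +ℤ σ m)) (ℕP.+-comm 1 m) ⟩
    + F *ℤ (Y ^ (m + 1) +ℤ σ m)        ∎
    where open ≡-Reasoning

module PathCountBounds (t : ℕ) where

  open PathCounts (suc t)

  pathCount-pos : ∀ ℓ → 1 ≤ pathCount x ℓ false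
  pathCount-pos zero    = s≤s z≤n
  pathCount-pos (suc ℓ) = ℕP.≤-trans (pathCount-pos ℓ)
    (ℕP.≤-trans (ℕP.m≤n*m (pathCount x ℓ false) (x ∸ 2)) (ℕP.m≤n+m _ (pathCount x ℓ true)))

  pathCount-suc≥ : ∀ ℓ → (x ∸ 1) * pathCount x ℓ false ≤ pathCount x (suc ℓ) false + 1
  pathCount-suc≥ ℓ = signed-sum⇒≤ ℓ (begin
    D (suc ℓ) +ℤ σ ℓ *ℤ + 1            ≡⟨ cong (D (suc ℓ) +ℤ_) (ℤP.*-identityʳ (σ ℓ)) ⟩
    D (suc ℓ) +ℤ σ ℓ                   ≡⟨ cong (_+ℤ σ ℓ) (D-suc ℓ) ⟩
    Y *ℤ D ℓ -ℤ σ ℓ +ℤ σ ℓ             ≡⟨ sub-add (Y *ℤ D ℓ) (σ ℓ) ⟩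
    Y *ℤ D ℓ                           ≡⟨ sym (ℤP.pos-* (x ∸ 1) (pathCount x ℓ false)) ⟩
    + ((x ∸ 1) * pathCount x ℓ false)  ∎)
    where
    open ≡-Reasoning
    sub-add : ∀ a σ → a -ℤ σ +ℤ σ ≡ a
    sub-add = solve-∀

  growth-exact : ∀ {E p} → E < pathCount x p false → ∀ r → E * (x ∸ 1) ℕ.^ r < pathCount x (r + p) false
  growth-exact {E} {p} E<D zero    = subst (_< pathCount x p false) (sym (ℕP.*-identityʳ E)) E<D
  growth-exact {E} {p} E<D (suc r) = ℕP.+-cancelʳ-≤ 1 (suc (E * (x ∸ 1) ℕ.^ suc r)) _ (begin
    suc (E * (y * y ℕ.^ r)) + 1        ≡⟨ cong (λ z → suc z + 1) (*-x∙yz≈y∙xz E y (y ℕ.^ r)) ⟩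
    suc (y * Z) + 1                    ≡⟨ ℕP.+-comm (suc (y * Z)) 1 ⟩
    2 + y * Z                          ≤⟨ ℕP.+-monoˡ-≤ (y * Z) {2} {y} (s≤s (s≤s z≤n)) ⟩
    y + y * Z                          ≡⟨ cong (_+ y * Z) (sym (ℕP.*-identityʳ y)) ⟩
    y * 1 + y * Z                      ≡⟨ sym (ℕP.*-distribˡ-+ y 1 Z) ⟩
    y * suc Z                          ≤⟨ ℕP.*-monoʳ-≤ y (growth-exact E<D r) ⟩
    y * pathCount x (r + p) false      ≤⟨ pathCount-suc≥ (r + p) ⟩
    pathCount x (suc r + p) false + 1  ∎)
    where
    open ℕP.≤-Reasoning
    y Z : ℕ
    y = x ∸ 1
    Z = E * y ℕ.^ r

  private
    cast₃ : ∀ a b c → + (a * b * c) ≡ + a *ℤ + b *ℤ + c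
    cast₃ a b c = trans (ℤP.pos-* (a * b) c) (cong (_*ℤ + c) (ℤP.pos-* a b))

  spider-identity : ∀ α β g →
    D (suc (α + β + suc g)) +ℤ σ g *ℤ + (pathCount x α false * pathCount x β false)
      ≡ + (spiderCount x α β (suc g) +
           pathCount x g false * ((x ∸ 1) * (pathCount x α false * pathCount x β false) +
                                  pathCount x α true * pathCount x β true))
  spider-identity α β g = begin
    D (suc (α + β + suc g)) +ℤ σ g *ℤ + (Pα * Pβ)
      ≡⟨ cong₂ (λ i p → D i +ℤ σ g *ℤ p) (cong suc (ℕP.+-suc (α + β) g)) (ℤP.pos-* Pα Pβ) ⟩
    D (suc (suc (α + β) + g)) +ℤ σ g *ℤ (D α *ℤ D β)
      ≡⟨ cong (_+ℤ σ g *ℤ (D α *ℤ D β)) (D-concat (suc (α + β)) g) ⟩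
    (Y +ℤ 1ℤ) *ℤ D (suc (α + β)) *ℤ D g -ℤ σ (suc (α + β)) *ℤ D g -ℤ σ g *ℤ D (suc (α + β))
      +ℤ σ g *ℤ (D α *ℤ D β)
      ≡⟨ cong₂ (λ d s → (Y +ℤ 1ℤ) *ℤ d *ℤ D g -ℤ s *ℤ D g -ℤ σ g *ℤ d +ℤ σ g *ℤ (D α *ℤ D β))
               (D-concat α β) (σ-suc-+ α β) ⟩
    (Y +ℤ 1ℤ) *ℤ ((Y +ℤ 1ℤ) *ℤ D α *ℤ D β -ℤ σ α *ℤ D β -ℤ σ β *ℤ D α) *ℤ D g
      -ℤ -1ℤ *ℤ (σ α *ℤ σ β) *ℤ D g
      -ℤ σ g *ℤ ((Y +ℤ 1ℤ) *ℤ D α *ℤ D β -ℤ σ α *ℤ D β -ℤ σ β *ℤ D α)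
      +ℤ σ g *ℤ (D α *ℤ D β)
      ≡⟨ rearrange Y (D α) (D β) (D g) (σ α) (σ β) (σ g) ⟩
    F (D α -ℤ σ α) (D β -ℤ σ β) (Y *ℤ D g -ℤ σ g) (Y *ℤ D g) (Y -ℤ (1ℤ +ℤ 1ℤ))
      ≡⟨ cong₂ (λ (sα , sβ) (dγ , sγ , T) → F sα sβ dγ sγ T)
               (cong₂ _,_ (sym (S≡D-σ α)) (sym (S≡D-σ β)))
               (cong₂ _,_ (sym (D-suc g)) (cong₂ _,_ (sym (S-suc g)) (sym +t≡Y-2))) ⟩
    F (S α) (S β) (D (suc g)) (S (suc g)) (+ t)
      ≡⟨ sym cast ⟩
    + (spiderCount x α β (suc g) + Pg * ((x ∸ 1) * (Pα * Pβ) + Sα * Sβ)) ∎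
    where
    open ≡-Reasoning
    Pα Pβ Pg Sα Sβ : ℕ
    Pα = pathCount x α false
    Pβ = pathCount x β false
    Pg = pathCount x g false
    Sα = pathCount x α true
    Sβ = pathCount x β true
    F : ℤ → ℤ → ℤ → ℤ → ℤ → ℤ
    F sα sβ dγ sγ T = sα *ℤ D β *ℤ dγ +ℤ D α *ℤ sβ *ℤ dγ +ℤ D α *ℤ D β *ℤ sγ +ℤ T *ℤ (D α *ℤ D β *ℤ dγ)
                      +ℤ D g *ℤ (Y *ℤ (D α *ℤ D β) +ℤ sα *ℤ sβ)
    +t≡Y-2 : + t ≡ Y -ℤ (1ℤ +ℤ 1ℤ)
    +t≡Y-2 = trans (add-sub (+ t)) (cong (_-ℤ (1ℤ +ℤ 1ℤ)) (sym (ℤP.pos-+ 2 t)))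
      where
      add-sub : ∀ T → T ≡ ((1ℤ +ℤ 1ℤ) +ℤ T) -ℤ (1ℤ +ℤ 1ℤ)
      add-sub = solve-∀
    rearrange : ∀ y da db dg σa σb σg →
      (y +ℤ 1ℤ) *ℤ ((y +ℤ 1ℤ) *ℤ da *ℤ db -ℤ σa *ℤ db -ℤ σb *ℤ da) *ℤ dg
        -ℤ -1ℤ *ℤ (σa *ℤ σb) *ℤ dg
        -ℤ σg *ℤ ((y +ℤ 1ℤ) *ℤ da *ℤ db -ℤ σa *ℤ db -ℤ σb *ℤ da)
        +ℤ σg *ℤ (da *ℤ db)
      ≡ (da -ℤ σa) *ℤ db *ℤ (y *ℤ dg -ℤ σg) +ℤ da *ℤ (db -ℤ σb) *ℤ (y *ℤ dg -ℤ σg)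
        +ℤ da *ℤ db *ℤ (y *ℤ dg) +ℤ (y -ℤ (1ℤ +ℤ 1ℤ)) *ℤ (da *ℤ db *ℤ (y *ℤ dg -ℤ σg))
        +ℤ dg *ℤ (y *ℤ (da *ℤ db) +ℤ (da -ℤ σa) *ℤ (db -ℤ σb))
    rearrange = solve-∀
    cast : + (spiderCount x α β (suc g) + Pg * ((x ∸ 1) * (Pα * Pβ) + Sα * Sβ))
             ≡ F (S α) (S β) (D (suc g)) (S (suc g)) (+ t)
    cast = begin
      + (spiderCount x α β (suc g) + Pg * ((x ∸ 1) * (Pα * Pβ) + Sα * Sβ))
        ≡⟨ ℤP.pos-+ (spiderCount x α β (suc g)) _ ⟩
      + spiderCount x α β (suc g) +ℤ + (Pg * ((x ∸ 1) * (Pα * Pβ) + Sα * Sβ))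
        ≡⟨ cong₂ _+ℤ_ castE castW ⟩
      F (S α) (S β) (D (suc g)) (S (suc g)) (+ t) ∎
      where
      Pγ Sγ : ℕ
      Pγ = pathCount x (suc g) false
      Sγ = pathCount x (suc g) true
      castE : + spiderCount x α β (suc g) ≡
        S α *ℤ D β *ℤ D (suc g) +ℤ D α *ℤ S β *ℤ D (suc g) +ℤ D α *ℤ D β *ℤ S (suc g) +ℤ + t *ℤ (D α *ℤ D β *ℤ D (suc g))
      castE = trans (ℤP.pos-+ (Sα * Pβ * Pγ + Pα * Sβ * Pγ + Pα * Pβ * Sγ) (t * (Pα * Pβ * Pγ))) (cong₂ _+ℤ_
                (trans (ℤP.pos-+ (Sα * Pβ * Pγ + Pα * Sβ * Pγ) (Pα * Pβ * Sγ))
                  (cong₂ _+ℤ_ (trans (ℤP.pos-+ (Sα * Pβ * Pγ) (Pα * Sβ * Pγ)) (cong₂ _+ℤ_ (cast₃ Sα Pβ Pγ) (cast₃ Pα Sβ Pγ)))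
                              (cast₃ Pα Pβ Sγ)))
                (trans (ℤP.pos-* t (Pα * Pβ * Pγ)) (cong (+ t *ℤ_) (cast₃ Pα Pβ Pγ))))
      castW : + (Pg * ((x ∸ 1) * (Pα * Pβ) + Sα * Sβ)) ≡ D g *ℤ (Y *ℤ (D α *ℤ D β) +ℤ S α *ℤ S β)
      castW = trans (ℤP.pos-* Pg _) (cong (D g *ℤ_) (trans (ℤP.pos-+ ((x ∸ 1) * (Pα * Pβ)) (Sα * Sβ))
                (cong₂ _+ℤ_ (trans (ℤP.pos-* (x ∸ 1) (Pα * Pβ)) (cong (Y *ℤ_) (ℤP.pos-* Pα Pβ))) (ℤP.pos-* Sα Sβ))))

  -- By spider-identity, D(α+β+γ+1) = E + W − (−1)^g P with W ≥ 2P and P ≥ 1.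
  spiderCount<pathCount : ∀ α β {γ} → 1 ≤ γ → spiderCount x α β γ < pathCount x (suc (α + β + γ)) false
  spiderCount<pathCount α β {suc g} _ = ℕP.+-cancelʳ-≤ P (suc E) N (begin
    suc E + P    ≡⟨ cong (_+ P) (ℕP.+-comm 1 E) ⟩
    E + 1 + P    ≤⟨ ℕP.+-monoˡ-≤ P (ℕP.+-monoʳ-≤ E P-pos) ⟩
    E + P + P    ≡⟨ ℕP.+-assoc E P P ⟩
    E + (P + P)  ≤⟨ ℕP.+-monoʳ-≤ E 2P≤W ⟩
    E + W        ≤⟨ signed-sum⇒≤ g (spider-identity α β g) ⟩
    N + P        ∎)
    where
    open ℕP.≤-Reasoning
    E N P W : ℕ
    E = spiderCount x α β (suc g)
    N = pathCount x (suc (α + β + suc g)) false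
    P = pathCount x α false * pathCount x β false
    W = pathCount x g false * ((x ∸ 1) * P + pathCount x α true * pathCount x β true)
    P-pos : 1 ≤ P
    P-pos = ℕP.*-mono-≤ (pathCount-pos α) (pathCount-pos β)
    2P≤W : P + P ≤ W
    2P≤W = begin
      P + P            ≤⟨ ℕP.+-monoʳ-≤ P (ℕP.m≤m+n P (t * P)) ⟩
      (x ∸ 1) * P      ≤⟨ ℕP.m≤m+n _ _ ⟩
      (x ∸ 1) * P + _  ≤⟨ ℕP.m≤n*m _ (pathCount x g false) {{ℕ.>-nonZero (pathCount-pos g)}} ⟩
      W                ∎

  growth : ∀ {E p r m} → E < pathCount x p false → r + p ≤ m → E * (x ∸ 1) ℕ.^ r < pathCount x m false
  growth {E} {p} {r} {m} E<D r+p≤m = begin-strict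
    E * (x ∸ 1) ℕ.^ r              ≤⟨ ℕP.*-monoʳ-≤ E (ℕP.^-monoʳ-≤ (x ∸ 1) r≤m∸p) ⟩
    E * (x ∸ 1) ℕ.^ (m ∸ p)        <⟨ growth-exact E<D (m ∸ p) ⟩
    pathCount x (m ∸ p + p) false  ≡⟨ cong (λ ℓ → pathCount x ℓ false) (ℕP.m∸n+n≡m (ℕP.m+n≤o⇒n≤o r r+p≤m)) ⟩
    pathCount x m false            ∎
    where
    open ℕP.≤-Reasoning
    r≤m∸p : r ≤ m ∸ p
    r≤m∸p = subst (_≤ m ∸ p) (ℕP.m+n∸n≡m r p) (ℕP.∸-monoˡ-≤ p r+p≤m)

  <-closedForm : ∀ {c F B m} → c ≤ x * F * B → B < pathCount x m false → 1 ≤ F →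
    + c <ℤ + F *ℤ (Y ^ (m + 1) +ℤ σ m)
  <-closedForm {c} {F} {B} {m} c≤ B<D F-pos = subst (+ c <ℤ_) (x*F*D-closedForm F m) (ℤ.+<+ (begin-strict
    c                            ≤⟨ c≤ ⟩
    x * F * B                    <⟨ ℕP.*-monoʳ-< (x * F) {{ℕ.>-nonZero (ℕP.*-mono-≤ {1} {x} (s≤s z≤n) F-pos)}} B<D ⟩
    x * F * pathCount x m false  ∎))
    where
    open ℕP.≤-Reasoning

fall-pos : ∀ y j → j ≤ y → 1 ≤ fall y j
fall-pos y       zero    _         = s≤s z≤n
fall-pos (suc y) (suc j) (s≤s j≤y) = ℕP.*-mono-≤ {1} {suc y} (s≤s z≤n) (fall-pos y j j≤y)

lemma2p6 : (k n : ℕ) → 4 ≤ k → k < n → (G : Graph n) → TwoConnected G →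
    ChromaticNumber G k → ThetaClique G k →
    (x : ℕ) → k ≤ x →
    + chromPoly G x <ℤ
    (+ fall (x ∸ 1) (k ∸ 1)) *ℤ ((+ (x ∸ 1)) ^ (n ∸ k + 1) +ℤ (-1ℤ ^ (n ∸ k)))
lemma2p6 _ n 4≤k@(s≤s {n = k′} _) _ G (_ , connected , _) _ θ x k≤x with ℕP.≤-trans 4≤k k≤x
... | s≤s (s≤s (s≤s (s≤s {n = t} _))) =
  <-closedForm {m = n ∸ suc k′} chromPoly-bound (growth {r = length rest} E<D r+p≤n∸k) F-pos
  where
  open ThetaCount {x = x} G connected θ using (pre; post; rest; chromPoly-bound; length-bound; length-I2≥1)
  open PathCountBounds (suc t) using (<-closedForm; growth; spiderCount<pathCount)
  γ p : ℕ
  γ = length (ThetaClique.I2 θ)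
  p = suc (length pre + length post + γ)
  E<D : spiderCount x (length pre) (length post) γ < pathCount x p false
  E<D = spiderCount<pathCount (length pre) (length post) length-I2≥1
  r+p≤n∸k : length rest + p ≤ n ∸ suc k′
  r+p≤n∸k = ℕP.m+n≤o⇒m≤o∸n (length rest + p) (subst (_≤ n) reorder length-bound)
    where
    reorder : suc k′ + p + length rest ≡ length rest + p + suc k′
    reorder = trans (ℕP.+-comm (suc k′ + p) (length rest))
                    (trans (cong (_+_ (length rest)) (ℕP.+-comm (suc k′) p)) (sym (ℕP.+-assoc (length rest) p (suc k′))))
  F-pos : 1 ≤ fall (x ∸ 1) k′
  F-pos = fall-pos (x ∸ 1) k′ (ℕP.≤-pred k≤x)
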